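{- Let $f\colon\{0,1\}^n\to\{0,1,\perp\}$ be a partial function, $F(x,y)=f(x\oplus y)$, and let $h\colon\{0,1\}^n\to\{0,1\}^t$, $\varphi\colon\{0,1\}^t\times\{0,1\}^n\to\{0,1\}$ be total functions with $\varphi(h(x),y)=F(x,y)$ for all $(x,y)\in\operatorname{Dom}(F)$. If $\Delta$ is a good shift for $h$ and $u,v\in\operatorname{Dom}(f)$ satisfy $u\oplus v=\Delta$, then $f(u)=f(v)$.
   Context: $\operatorname{Dom}(f)=f^{ -1}(\{0,1\})$, $\oplus$ is bitwise XOR, $\operatorname{Dom}(F)=\{(x,y):x\oplus y\in\operatorname{Dom}(f)\}$. A vector $\Delta\in\{0,1\}^n$ is a good shift for $h$ if there exist $x,y\in\{0,1\}^n$ with $x\oplus y=\Delta$ and $h(x)=h(y)$. -}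

module Defs where

open import Data.Bool using (Bool; _xor_)
open import Data.Maybe using (Maybe; just; nothing)
open import Data.Nat using (ℕ)
open import Data.Vec using (Vec; zipWith)
open import Data.Product using (Σ; ∃; _×_; _,_)
open import Relation.Binary.PropositionalEquality using (_≡_)

Bits : ℕ → Set
Bits n = Vec Bool n

_⊕_ : ∀ {n} → Bits n → Bits n → Bits n
_⊕_ = zipWith _xor_

-- partial Boolean function {0,1}^n → {0,1,⊥}; nothing represents ⊥
Partial : ℕ → Set
Partial n = Bits n → Maybe Bool

Dom : ∀ {n} → Partial n → Bits n → Set
Dom f x = ∃ λ b → f x ≡ just b

XorLift : ∀ {n} → Partial n → Bits n → Bits n → Maybe Bool
XorLift f x y = f (x ⊕ y)

DomF : ∀ {n} → Partial n → Bits n → Bits n → Set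
DomF f x y = Dom f (x ⊕ y)

GoodShift : ∀ {n t} → (Bits n → Bits t) → Bits n → Set
GoodShift {n} h Δ = Σ (Bits n) λ x → Σ (Bits n) λ y → (x ⊕ y ≡ Δ) × (h x ≡ h y)

module Submission where

open import Defs
open import Data.Bool using (Bool; _xor_)
open import Data.Bool.Properties using (xor-assoc; xor-comm; xor-same)
open import Data.Maybe using (just)
open import Data.Nat using (ℕ)
open import Data.Vec using ([]; _∷_)
open import Data.Vec.Properties using (zipWith-assoc; zipWith-comm)
open import Data.Product using (_,_)
open import Relation.Binary.PropositionalEquality

-- Proof idea: a collision h x = h y with x ⊕ y = Δ means the protocol sees the
-- same message on inputs (x, w) and (y, w), so F(x, w) = F(y, w) whenever both
-- are defined. Taking w = x ⊕ u gives x ⊕ w = u and y ⊕ w = v.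

⊕-assoc : ∀ {n} (a b c : Bits n) → (a ⊕ b) ⊕ c ≡ a ⊕ (b ⊕ c)
⊕-assoc = zipWith-assoc xor-assoc

⊕-comm : ∀ {n} (a b : Bits n) → a ⊕ b ≡ b ⊕ a
⊕-comm = zipWith-comm xor-comm

xor-cancelˡ : ∀ a b → a xor (a xor b) ≡ b
xor-cancelˡ a b = trans (sym (xor-assoc a a b)) (cong (_xor b) (xor-same a))

⊕-cancelˡ : ∀ {n} (a b : Bits n) → a ⊕ (a ⊕ b) ≡ b
⊕-cancelˡ []       []       = refl
⊕-cancelˡ (a ∷ as) (b ∷ bs) = cong₂ _∷_ (xor-cancelˡ a b) (⊕-cancelˡ as bs)

⊕-shift : ∀ {n} (x y u : Bits n) → y ⊕ (x ⊕ u) ≡ (x ⊕ y) ⊕ u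
⊕-shift x y u = begin
  y ⊕ (x ⊕ u) ≡⟨ ⊕-assoc y x u ⟨
  (y ⊕ x) ⊕ u ≡⟨ cong (_⊕ u) (⊕-comm y x) ⟩
  (x ⊕ y) ⊕ u ∎
  where open ≡-Reasoning

XorLift-cong-collision :
  ∀ {n t} (f : Partial n) (h : Bits n → Bits t) (φ : Bits t → Bits n → Bool) →
  (∀ x y → DomF f x y → just (φ (h x) y) ≡ XorLift f x y) →
  ∀ {x y} → h x ≡ h y → ∀ w → DomF f x w → DomF f y w →
  XorLift f x w ≡ XorLift f y w
XorLift-cong-collision f h φ computes {x} {y} hx≡hy w dx dy = begin
  XorLift f x w      ≡⟨ computes x w dx ⟨
  just (φ (h x) w)   ≡⟨ cong (λ m → just (φ m w)) hx≡hy ⟩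
  just (φ (h y) w)   ≡⟨ computes y w dy ⟩
  XorLift f y w      ∎
  where open ≡-Reasoning

lemma14 : (n t : ℕ) (f : Partial n) (h : Bits n → Bits t) (φ : Bits t → Bits n → Bool) →
          (∀ x y → DomF f x y → just (φ (h x) y) ≡ XorLift f x y) →
          (Δ : Bits n) → GoodShift h Δ →
          (u v : Bits n) → Dom f u → Dom f v → u ⊕ v ≡ Δ →
          f u ≡ f v
lemma14 n t f h φ computes Δ (x , y , x⊕y≡Δ , hx≡hy) u v du dv u⊕v≡Δ =
  subst₂ (λ a b → f a ≡ f b) x⊕w≡u y⊕w≡v
    (XorLift-cong-collision f h φ computes hx≡hy w
      (subst (Dom f) (sym x⊕w≡u) du) (subst (Dom f) (sym y⊕w≡v) dv))
  where
  w : Bits n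
  w = x ⊕ u
  x⊕w≡u : x ⊕ w ≡ u
  x⊕w≡u = ⊕-cancelˡ x u
  y⊕w≡v : y ⊕ w ≡ v
  y⊕w≡v = begin
    y ⊕ (x ⊕ u)  ≡⟨ ⊕-shift x y u ⟩
    (x ⊕ y) ⊕ u  ≡⟨ cong (_⊕ u) (trans x⊕y≡Δ (sym u⊕v≡Δ)) ⟩
    (u ⊕ v) ⊕ u  ≡⟨ ⊕-comm (u ⊕ v) u ⟩
    u ⊕ (u ⊕ v)  ≡⟨ ⊕-cancelˡ u v ⟩
    v            ∎
    where open ≡-Reasoning
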